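{- Let $R$ be a finite commutative chain ring. If the uniform matroid $U_{k,n}$ is representable over $R$, then it is freely representable over $R$.
   Context: $R$ is local with maximal ideal $\mathfrak{m}$. Vectors $v_1,\dots,v_\ell$ are modular independent if $\sum\alpha_iv_i=0$ implies all $\alpha_i\in\mathfrak{m}$. For an $R$-module $V$ and $A\colon E\to V$, $M[A]$ is the independence system on $E$ whose independent sets are the $I$ with $(A(i))_{i\in I}$ modular independent. A matroid $M$ is representable over $R$ if $M\cong M[A]$ for some finite set $E$, $R$-module $V$, and $A\colon E\to V$; it is freely representable over $R$ if moreover one can take $V=R^k$ and $A$ a $k\times |E|$ matrix which, after a permutation of columns, has the form $[I_k\mid P]$. $U_{k,n}$ is the uniform matroid of rank $k$ on $n$ elements. -}

module Defs where

open import Level using (Level; _⊔_) renaming (suc to lsuc)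
open import Data.Nat using (ℕ; zero; suc; _≤_) renaming (_+_ to _+ℕ_)
open import Data.Fin using (Fin; zero; suc; _↑ˡ_)
open import Data.Fin.Subset using (Subset; _∈_; ∣_∣)
open import Data.Vec using ([]; _∷_)
open import Data.Bool using (true; false)
open import Data.Product using (Σ; ∃; _×_; _,_)
open import Data.Sum using (_⊎_)
open import Relation.Nullary using (¬_)
open import Relation.Binary.PropositionalEquality using (_≡_)
open import Function.Bundles using (_↔_; _⇔_; Inverse)
open import Algebra.Bundles using (CommutativeRing)
open import Algebra.Module.Bundles using (Module)

subsetSum : ∀ {a} {M : Set a} → M → (M → M → M) →
            ∀ {n} → Subset n → (Fin n → M) → M
subsetSum z _⊕_ {zero}  []          f = z
subsetSum z _⊕_ {suc n} (true  ∷ I) f = f zero ⊕ subsetSum z _⊕_ I (λ i → f (suc i))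
subsetSum z _⊕_ {suc n} (false ∷ I) f = subsetSum z _⊕_ I (λ i → f (suc i))

module _ {c ℓ} (R : CommutativeRing c ℓ) where
  open CommutativeRing R

  IsUnit : Carrier → Set (c ⊔ ℓ)
  IsUnit x = ∃ λ y → x * y ≈ 1#

  𝔪 : Carrier → Set (c ⊔ ℓ)
  𝔪 x = ¬ IsUnit x

  -- R is local: 1 ≠ 0 and the non-units are closed under addition
  -- (equivalently, the non-units form the unique maximal ideal).
  IsLocal : Set (c ⊔ ℓ)
  IsLocal = (¬ (1# ≈ 0#)) × (∀ x y → 𝔪 x → 𝔪 y → 𝔪 (x + y))

  record IsIdeal (I : Carrier → Set (c ⊔ ℓ)) : Set (c ⊔ ℓ) where
    field
      resp  : ∀ {x y} → x ≈ y → I x → I y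
      has0  : I 0#
      +-cl  : ∀ {x y} → I x → I y → I (x + y)
      *-cl  : ∀ r {x} → I x → I (r * x)

  _⊆ᵢ_ : (Carrier → Set (c ⊔ ℓ)) → (Carrier → Set (c ⊔ ℓ)) → Set (c ⊔ ℓ)
  I ⊆ᵢ J = ∀ {x} → I x → J x

  IsFinite : Set (c ⊔ ℓ)
  IsFinite = Σ ℕ λ q → Σ (Fin q → Carrier) λ f → ∀ x → ∃ λ i → f i ≈ x

  IsChainRing : Set (lsuc (c ⊔ ℓ))
  IsChainRing = IsLocal ×
    (∀ I J → IsIdeal I → IsIdeal J → (I ⊆ᵢ J) ⊎ (J ⊆ᵢ I))

  IsFiniteChainRing : Set (lsuc (c ⊔ ℓ))
  IsFiniteChainRing = IsFinite × IsChainRing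

  ModIndepIn : ∀ {m ℓm} {M : Set m} (_≈M_ : M → M → Set ℓm) (_+M_ : M → M → M) (0M : M)
               (_·_ : Carrier → M → M) {n} → (Fin n → M) → Subset n → Set (c ⊔ ℓ ⊔ ℓm)
  ModIndepIn _≈M_ _+M_ 0M _·_ v I =
    ∀ (α : Fin _ → Carrier) →
      subsetSum 0M _+M_ I (λ i → α i · v i) ≈M 0M →
      ∀ i → i ∈ I → 𝔪 (α i)

  ModIndep : ∀ {m ℓm} (V : Module R m ℓm) {n} →
             (Fin n → Module.Carrierᴹ V) → Subset n → Set (c ⊔ ℓ ⊔ ℓm)
  ModIndep V = ModIndepIn _≈ᴹ_ _+ᴹ_ 0ᴹ _*ₗ_
    where open Module V

  ModIndepFree : ∀ k {n} → (Fin n → (Fin k → Carrier)) → Subset n → Set (c ⊔ ℓ)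
  ModIndepFree k = ModIndepIn (λ u w → ∀ r → u r ≈ w r)
                              (λ u w r → u r + w r) (λ _ → 0#) (λ a u r → a * u r)

  -- Matroids on the ground set Fin n, given by their independence predicate.
  -- M ≅ M[A] means: there is a bijection σ between the ground sets such that
  -- I is independent in M iff (A (σ i))_{i ∈ I} is modular independent.

  Representable : ∀ m ℓm {n} → (Subset n → Set) → Set (c ⊔ ℓ ⊔ lsuc (m ⊔ ℓm))
  Representable m ℓm {n} Indep =
    Σ ℕ λ e →
    Σ (Module R m ℓm) λ V →
    Σ (Fin e → Module.Carrierᴹ V) λ A →
    Σ (Fin n ↔ Fin e) λ σ →
      ∀ I → Indep I ⇔ ModIndep V (λ i → A (Inverse.to σ i)) I

  -- Freely representable: V = R^k and A a k × |E| matrix (A r j = entry in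
  -- row r, column j) which after a permutation π of the columns is [I_k ∣ P].
  FreelyRepresentable : ∀ {n} → (Subset n → Set) → Set (c ⊔ ℓ)
  FreelyRepresentable {n} Indep =
    Σ ℕ λ k → Σ ℕ λ p →
    Σ (Fin k → Fin (k +ℕ p) → Carrier) λ A →
    Σ (Fin (k +ℕ p) ↔ Fin (k +ℕ p)) λ π →
      (∀ (r j : Fin k) →
         (r ≡ j → A r (Inverse.to π (j ↑ˡ p)) ≈ 1#) ×
         (¬ (r ≡ j) → A r (Inverse.to π (j ↑ˡ p)) ≈ 0#)) ×
    Σ (Fin n ↔ Fin (k +ℕ p)) λ σ →
      ∀ I → Indep I ⇔ ModIndepFree k (λ i r → A r (Inverse.to σ i)) I

UniformIndep : (k n : ℕ) → Subset n → Set
UniformIndep k n I = ∣ I ∣ ≤ k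

{-# OPTIONS --safe #-}

-- Write n = k + p and let w : Fin n → V represent U_{k,n}. The first k vectors together
-- with any further one are dependent, so some relation among them has a unit coefficient.
-- If that coefficient sits on the further vector, it lies in the span of the first k;
-- otherwise swapping it with the basis vector carrying the unit does not shrink the span
-- and, being a permutation, keeps w a representation of U_{k,n}. After p such steps every
-- vector is a combination of the first k, and the coordinates form a matrix [I_k ∣ P].
-- Its columns are independent on every set of size ≤ k because w is, and dependent on
-- larger sets because over a chain ring divisibility is total: elimination with a pivot
-- of least divisibility gives more than k vectors of R^k a relation with a unit coefficient.
--
-- Constructively the exchange argument only yields ¬ ¬ ∃ P. But a chain ring decides every
-- ¬¬-stable proposition, the property required of P is ¬¬-stable, and P ranges over a
-- finite set, so P can be found by search.

module Submission where

open import Defs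
open import Level using (Level; _⊔_; Lift; lift) renaming (suc to lsuc)
open import Data.Nat using (ℕ; zero; suc; _≤_; _<_; _≤?_; z<s; s<s) renaming (_+_ to _+ℕ_)
import Data.Nat.Properties as ℕ
open import Data.Nat.Properties
  using ( +-0-commutativeMonoid; ≤-refl; ≤-trans; <-trans; <⇒≤; <⇒≢; ≰⇒>; ≰⇒≥; n≮n
        ; m<1+n⇒m<n∨m≡n; m≤n⇒∃[o]m+o≡n)
open import Data.Fin using (Fin; zero; suc; _↑ˡ_; _↑ʳ_; splitAt; toℕ; fromℕ<; _≟_)
open import Data.Fin.Properties
  using ( any?; suc-injective; ↑ˡ-injective; ↑ʳ-injective; splitAt-↑ˡ; join-splitAt
        ; toℕ<n; toℕ-fromℕ<; toℕ-injective)
open import Data.Fin.Subset using (Subset; _∈_; _∉_; _─_; ∣_∣; ⊤; ⊥; ⁅_⁆; Nonempty; inside; outside)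
open import Data.Fin.Subset.Properties
  using ( _∈?_; ∈⊤; ∉⊥; x∈⁅x⁆; x∈⁅y⁆⇒x≡y; p─⊥≡p; p─q⊆p; nonempty?; Empty-unique
        ; ∣⊥∣≡0; ∣⊤∣≡n; ∣⁅x⁆∣≡1; ∣p∣≤n)
open import Data.Fin.Permutation using (Permutation; _⟨$⟩ʳ_; _⟨$⟩ˡ_; inverseˡ; inverseʳ; transpose)
import Data.Fin.Permutation.Components as PC
open import Data.Vec using ([]; _∷_; _++_; lookup; tabulate; here; there)
open import Data.Vec.Properties using (lookup∘tabulate; lookup⇒[]=; []=⇒lookup)
import Data.Vec.Functional as Vector
open import Data.Vec.Functional using (head; tail; updateAt)
open import Data.Vec.Functional.Properties using (updateAt-updates; updateAt-minimal)
open import Data.Vec.Functional.Relation.Binary.Pointwise using (Pointwise)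
open import Data.Bool using (if_then_else_)
open import Data.Product using (∃; ∃-syntax; Σ-syntax; _×_; _,_; proj₁; proj₂)
open import Data.Sum using (_⊎_; inj₁; inj₂; [_,_]′)
open import Function using (_∘_; id; _⇔_; mk⇔; Equivalence; Inverse)
open import Function.Construct.Identity using (↔-id)
open import Relation.Nullary using (¬_; Dec; yes; no; does; contradiction)
open import Relation.Nullary.Negation using (Stable; ¬¬-map; negated-stable)
open import Relation.Nullary.Decidable using (dec-true; dec-false; decidable-stable)
import Relation.Nullary.Decidable as Dec
open import Relation.Unary using (Pred; Decidable)
open import Relation.Binary using (Rel; Reflexive; Symmetric)
open import Relation.Binary.Definitions using (_Respects_)
open import Relation.Binary.PropositionalEquality as ≡ using (_≡_; _≢_)
open import Algebra.Bundles using (CommutativeMonoid; CommutativeRing)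
open import Algebra.Module.Bundles using (Module)
import Algebra.Properties.CommutativeMonoid.Sum as MonoidSum
import Algebra.Properties.CommutativeSemigroup as CommutativeSemigroupProperties
import Algebra.Properties.Ring as RingProperties

image : ∀ {n} → Permutation n n → Subset n → Subset n
image ρ I = tabulate (lookup I ∘ (ρ ⟨$⟩ˡ_))

∈-image : ∀ {n} (ρ : Permutation n n) {I : Subset n} {i} → i ∈ I → ρ ⟨$⟩ʳ i ∈ image ρ I
∈-image ρ {I} {i} i∈I = lookup⇒[]= _ (image ρ I) (begin
  lookup (image ρ I) (ρ ⟨$⟩ʳ i)  ≡⟨ lookup∘tabulate _ (ρ ⟨$⟩ʳ i) ⟩
  lookup I (ρ ⟨$⟩ˡ (ρ ⟨$⟩ʳ i))   ≡⟨ ≡.cong (lookup I) (inverseˡ ρ) ⟩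
  lookup I i                     ≡⟨ []=⇒lookup i∈I ⟩
  inside                         ∎)
  where open ≡.≡-Reasoning

image-∈ : ∀ {n} (ρ : Permutation n n) {I : Subset n} {x} → x ∈ image ρ I → ρ ⟨$⟩ˡ x ∈ I
image-∈ ρ {I} {x} x∈ρI = lookup⇒[]= _ I (≡.trans (≡.sym (lookup∘tabulate _ x)) ([]=⇒lookup x∈ρI))

x∈p─q⇒x∉q : ∀ {n} {x : Fin n} (p q : Subset n) → x ∈ p ─ q → x ∉ q
x∈p─q⇒x∉q (inside ∷ p) (outside ∷ q) here          ()
x∈p─q⇒x∉q (_      ∷ p) (_       ∷ q) (there x∈p─q) (there x∈q) = x∈p─q⇒x∉q p q x∈p─q x∈q

x∈p─⁅y⁆⇒x≢y : ∀ {n} {x y : Fin n} (p : Subset n) → x ∈ p ─ ⁅ y ⁆ → x ≢ y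
x∈p─⁅y⁆⇒x≢y {y = y} p x∈p─y ≡.refl = x∈p─q⇒x∉q p ⁅ y ⁆ x∈p─y (x∈⁅x⁆ y)

0<∣p∣⇒nonempty : ∀ {n} (I : Subset n) → 0 < ∣ I ∣ → Nonempty I
0<∣p∣⇒nonempty {n} I 0<∣I∣ with nonempty? I
... | yes I-nonempty = I-nonempty
... | no  I-empty
  with () ← ≡.subst (0 <_) (≡.trans (≡.cong ∣_∣ (Empty-unique I-empty)) (∣⊥∣≡0 n)) 0<∣I∣

↑ˡ≢↑ʳ : ∀ {m n} (i : Fin m) (j : Fin n) → i ↑ˡ n ≢ m ↑ʳ j
↑ˡ≢↑ʳ (suc i) j eq = ↑ˡ≢↑ʳ i j (suc-injective eq)

↑ʳ-∈-++ : ∀ {m n} (I : Subset m) (J : Subset n) {j} → m ↑ʳ j ∈ I ++ J → j ∈ J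
↑ʳ-∈-++ []      J j∈J         = j∈J
↑ʳ-∈-++ (_ ∷ I) J (there j∈J) = ↑ʳ-∈-++ I J j∈J

transpose-matchˡ : ∀ {n} (i j : Fin n) → PC.transpose i j i ≡ j
transpose-matchˡ i j rewrite dec-true (i ≟ i) ≡.refl = ≡.refl

transpose-matchʳ : ∀ {n} (i j : Fin n) → PC.transpose i j j ≡ i
transpose-matchʳ i j with j ≟ i
... | yes j≡i = j≡i
... | no  _   rewrite dec-true (j ≟ j) ≡.refl = ≡.refl

transpose-other : ∀ {n} {i j k : Fin n} → k ≢ i → k ≢ j → PC.transpose i j k ≡ k
transpose-other {i = i} {j} {k} k≢i k≢j rewrite dec-false (k ≟ i) k≢i | dec-false (k ≟ j) k≢j = ≡.refl

module SubsetSum {a ℓ} (M : CommutativeMonoid a ℓ) where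
  open CommutativeMonoid M
  open CommutativeSemigroupProperties commutativeSemigroup using (interchange; x∙yz≈y∙xz; xy∙z≈zy∙x)
  open MonoidSum M using (sum; sum-permute; sum-cong-≗)
  open import Relation.Binary.Reasoning.Setoid setoid

  sumOver : ∀ {n} → Subset n → (Fin n → Carrier) → Carrier
  sumOver = subsetSum ε _∙_

  sumOver-cong-∈ : ∀ {n} (I : Subset n) {f g : Fin n → Carrier} →
                   (∀ i → i ∈ I → f i ≈ g i) → sumOver I f ≈ sumOver I g
  sumOver-cong-∈ []            f≈g = refl
  sumOver-cong-∈ (inside  ∷ I) f≈g = ∙-cong (f≈g zero here) (sumOver-cong-∈ I (λ i → f≈g (suc i) ∘ there))
  sumOver-cong-∈ (outside ∷ I) f≈g = sumOver-cong-∈ I (λ i → f≈g (suc i) ∘ there)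

  sumOver-cong : ∀ {n} (I : Subset n) {f g : Fin n → Carrier} →
                 (∀ i → f i ≈ g i) → sumOver I f ≈ sumOver I g
  sumOver-cong I f≈g = sumOver-cong-∈ I (λ i _ → f≈g i)

  sumOver-ε : ∀ {n} (I : Subset n) {f : Fin n → Carrier} →
              (∀ i → i ∈ I → f i ≈ ε) → sumOver I f ≈ ε
  sumOver-ε I f≈ε = trans (sumOver-cong-∈ I f≈ε) (sumOver-const-ε I)
    where
    sumOver-const-ε : ∀ {n} (J : Subset n) → sumOver J (λ _ → ε) ≈ ε
    sumOver-const-ε []            = refl
    sumOver-const-ε (inside  ∷ J) = trans (∙-congˡ (sumOver-const-ε J)) (identityˡ ε)
    sumOver-const-ε (outside ∷ J) = sumOver-const-ε J

  sumOver-distrib : ∀ {n} (I : Subset n) (f g : Fin n → Carrier) →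
                    sumOver I (λ i → f i ∙ g i) ≈ sumOver I f ∙ sumOver I g
  sumOver-distrib []            f g = sym (identityˡ ε)
  sumOver-distrib (inside  ∷ I) f g = trans (∙-congˡ (sumOver-distrib I _ _)) (interchange _ _ _ _)
  sumOver-distrib (outside ∷ I) f g = sumOver-distrib I _ _

  sumOver-comm : ∀ {m n} (I : Subset m) (J : Subset n) (f : Fin m → Fin n → Carrier) →
                 sumOver I (λ i → sumOver J (f i)) ≈ sumOver J (λ j → sumOver I (λ i → f i j))
  sumOver-comm []            J f = sym (sumOver-ε J (λ _ _ → refl))
  sumOver-comm (inside  ∷ I) J f = trans (∙-congˡ (sumOver-comm I J _)) (sym (sumOver-distrib J _ _))
  sumOver-comm (outside ∷ I) J f = sumOver-comm I J _

  sumOver-remove : ∀ {n} (I : Subset n) {t} (f : Fin n → Carrier) → t ∈ I →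
                   sumOver I f ≈ f t ∙ sumOver (I ─ ⁅ t ⁆) f
  sumOver-remove (inside ∷ I) {zero} f here =
    ∙-congˡ (reflexive (≡.cong (λ J → sumOver J (f ∘ suc)) (≡.sym (p─⊥≡p I))))
  sumOver-remove (inside ∷ I) {suc t} f (there t∈I) =
    trans (∙-congˡ (sumOver-remove I _ t∈I)) (x∙yz≈y∙xz _ _ _)
  sumOver-remove (outside ∷ I) {suc t} f (there t∈I) = sumOver-remove I _ t∈I

  sumOver-⁅⁆ : ∀ {n} (t : Fin n) (f : Fin n → Carrier) → sumOver ⁅ t ⁆ f ≈ f t
  sumOver-⁅⁆ zero    f =
    trans (∙-congˡ (sumOver-ε ⊥ {f ∘ suc} (λ _ i∈⊥ → contradiction i∈⊥ ∉⊥))) (identityʳ (f zero))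
  sumOver-⁅⁆ (suc t) f = sumOver-⁅⁆ t (f ∘ suc)

  sumOver-++ : ∀ {m n} (I : Subset m) (J : Subset n) (f : Fin (m +ℕ n) → Carrier) →
               sumOver (I ++ J) f ≈ sumOver I (λ i → f (i ↑ˡ n)) ∙ sumOver J (λ j → f (m ↑ʳ j))
  sumOver-++ []            J f = sym (identityˡ _)
  sumOver-++ (inside  ∷ I) J f = trans (∙-congˡ (sumOver-++ I J _)) (sym (assoc _ _ _))
  sumOver-++ (outside ∷ I) J f = sumOver-++ I J _

  sumOver-exchange : ∀ {n} (I : Subset n) {t} (f g : Fin n → Carrier) → t ∈ I →
                     (∀ i → i ∈ I ─ ⁅ t ⁆ → f i ≈ g i) → sumOver I g ∙ f t ≈ sumOver I f ∙ g t
  sumOver-exchange I {t} f g t∈I f≈g = begin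
    sumOver I g ∙ f t                    ≈⟨ ∙-congʳ (sumOver-remove I g t∈I) ⟩
    (g t ∙ sumOver (I ─ ⁅ t ⁆) g) ∙ f t  ≈⟨ ∙-congʳ (∙-congˡ (sumOver-cong-∈ (I ─ ⁅ t ⁆) f≈g)) ⟨
    (g t ∙ sumOver (I ─ ⁅ t ⁆) f) ∙ f t  ≈⟨ xy∙z≈zy∙x _ _ _ ⟩
    (f t ∙ sumOver (I ─ ⁅ t ⁆) f) ∙ g t  ≈⟨ ∙-congʳ (sumOver-remove I f t∈I) ⟨
    sumOver I f ∙ g t                    ∎

  sumOver-permute : ∀ {n} (ρ : Permutation n n) (I : Subset n) (f : Fin n → Carrier) →
                    sumOver (image ρ I) f ≈ sumOver I (f ∘ (ρ ⟨$⟩ʳ_))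
  sumOver-permute ρ I f = begin
    sumOver (image ρ I) f                     ≈⟨ sumOver≈sum (image ρ I) f ⟩
    sum (restrict (image ρ I) f)              ≈⟨ sum-permute _ ρ ⟩
    sum (restrict (image ρ I) f ∘ (ρ ⟨$⟩ʳ_))  ≡⟨ sum-cong-≗ restrict-image ⟩
    sum (restrict I (f ∘ (ρ ⟨$⟩ʳ_)))          ≈⟨ sumOver≈sum I _ ⟨
    sumOver I (f ∘ (ρ ⟨$⟩ʳ_))                 ∎
    where
    restrict : ∀ {n} → Subset n → (Fin n → Carrier) → Fin n → Carrier
    restrict I f i = if lookup I i then f i else ε
    sumOver≈sum : ∀ {n} (I : Subset n) f → sumOver I f ≈ sum (restrict I f)
    sumOver≈sum []            f = refl
    sumOver≈sum (inside  ∷ I) f = ∙-congˡ (sumOver≈sum I _)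
    sumOver≈sum (outside ∷ I) f = trans (sumOver≈sum I _) (sym (identityˡ _))
    restrict-image : ∀ i → restrict (image ρ I) f (ρ ⟨$⟩ʳ i) ≡ restrict I (f ∘ (ρ ⟨$⟩ʳ_)) i
    restrict-image i rewrite lookup∘tabulate (lookup I ∘ (ρ ⟨$⟩ˡ_)) (ρ ⟨$⟩ʳ i) | inverseˡ ρ {i} = ≡.refl

module SubsetSumHomomorphism {a₁ ℓ₁ a₂ ℓ₂} (M : CommutativeMonoid a₁ ℓ₁) (N : CommutativeMonoid a₂ ℓ₂) where
  private
    module M = CommutativeMonoid M
    module N = CommutativeMonoid N
  open SubsetSum M using () renaming (sumOver to sumOverᴹ)
  open SubsetSum N using () renaming (sumOver to sumOverᴺ)

  sumOver-hom : (h : M.Carrier → N.Carrier) → h M.ε N.≈ N.ε → (∀ x y → h (x M.∙ y) N.≈ h x N.∙ h y) →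
                ∀ {n} (I : Subset n) f → h (sumOverᴹ I f) N.≈ sumOverᴺ I (h ∘ f)
  sumOver-hom h h-ε h-∙ []            f = h-ε
  sumOver-hom h h-ε h-∙ (inside  ∷ I) f = N.trans (h-∙ _ _) (N.∙-congˡ (sumOver-hom h h-ε h-∙ I _))
  sumOver-hom h h-ε h-∙ (outside ∷ I) f = sumOver-hom h h-ε h-∙ I _

module ℕSum = SubsetSum +-0-commutativeMonoid

∣p∣≡sumOver : ∀ {n} (I : Subset n) → ∣ I ∣ ≡ ℕSum.sumOver I (λ _ → 1)
∣p∣≡sumOver []            = ≡.refl
∣p∣≡sumOver (inside  ∷ I) = ≡.cong suc (∣p∣≡sumOver I)
∣p∣≡sumOver (outside ∷ I) = ∣p∣≡sumOver I

∣image∣≡∣p∣ : ∀ {n} (ρ : Permutation n n) (I : Subset n) → ∣ image ρ I ∣ ≡ ∣ I ∣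
∣image∣≡∣p∣ ρ I = begin
  ∣ image ρ I ∣                       ≡⟨ ∣p∣≡sumOver (image ρ I) ⟩
  ℕSum.sumOver (image ρ I) (λ _ → 1)  ≡⟨ ℕSum.sumOver-permute ρ I _ ⟩
  ℕSum.sumOver I (λ _ → 1)            ≡⟨ ∣p∣≡sumOver I ⟨
  ∣ I ∣                               ∎
  where open ≡.≡-Reasoning

∣p∣≡1+∣p─⁅x⁆∣ : ∀ {n} (I : Subset n) {t} → t ∈ I → ∣ I ∣ ≡ suc ∣ I ─ ⁅ t ⁆ ∣
∣p∣≡1+∣p─⁅x⁆∣ I {t} t∈I = begin
  ∣ I ∣                                     ≡⟨ ∣p∣≡sumOver I ⟩
  ℕSum.sumOver I (λ _ → 1)                  ≡⟨ ℕSum.sumOver-remove I _ t∈I ⟩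
  suc (ℕSum.sumOver (I ─ ⁅ t ⁆) (λ _ → 1))  ≡⟨ ≡.cong suc (∣p∣≡sumOver (I ─ ⁅ t ⁆)) ⟨
  suc ∣ I ─ ⁅ t ⁆ ∣                         ∎
  where open ≡.≡-Reasoning

∣p++q∣≡∣p∣+∣q∣ : ∀ {m n} (I : Subset m) (J : Subset n) → ∣ I ++ J ∣ ≡ ∣ I ∣ +ℕ ∣ J ∣
∣p++q∣≡∣p∣+∣q∣ I J = begin
  ∣ I ++ J ∣                                             ≡⟨ ∣p∣≡sumOver (I ++ J) ⟩
  ℕSum.sumOver (I ++ J) (λ _ → 1)                        ≡⟨ ℕSum.sumOver-++ I J _ ⟩
  ℕSum.sumOver I (λ _ → 1) +ℕ ℕSum.sumOver J (λ _ → 1)  ≡⟨ ≡.cong₂ _+ℕ_ (∣p∣≡sumOver I) (∣p∣≡sumOver J) ⟨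
  ∣ I ∣ +ℕ ∣ J ∣                                         ∎
  where open ≡.≡-Reasoning

module ChainRing {c ℓ} (R : CommutativeRing c ℓ) (chain : IsChainRing R) where
  open CommutativeRing R hiding (zero)
  open import Algebra.Properties.Semiring.Divisibility semiring
    using (_∣_; _,_; _∣0; ∣ʳ-refl; ∣ʳ-trans; ∣ʳ-respʳ-≈)

  1≉0 : ¬ 1# ≈ 0#
  1≉0 = proj₁ (proj₁ chain)

  zeroOr : Set (c ⊔ ℓ) → Carrier → Set (c ⊔ ℓ)
  zeroOr X x = Lift c (x ≈ 0#) ⊎ X

  zeroOr-isIdeal : ∀ X → IsIdeal R (zeroOr X)
  zeroOr-isIdeal X = record
    { resp = λ { x≈y (inj₁ (lift x≈0)) → inj₁ (lift (trans (sym x≈y) x≈0))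
               ; _   (inj₂ x)          → inj₂ x }
    ; has0 = inj₁ (lift refl)
    ; +-cl = λ { (inj₁ (lift x≈0)) (inj₁ (lift y≈0)) → inj₁ (lift (trans (+-cong x≈0 y≈0) (+-identityˡ 0#)))
               ; (inj₁ _)          (inj₂ x)          → inj₂ x
               ; (inj₂ x)          _                 → inj₂ x }
    ; *-cl = λ { r (inj₁ (lift x≈0)) → inj₁ (lift (trans (*-congˡ x≈0) (zeroʳ r)))
               ; r (inj₂ x)          → inj₂ x }
    }

  -- zeroOr X is the whole ring if X holds and zero otherwise,
  -- so comparing it with zeroOr (¬ X) at 1# refutes X or ¬ X.
  weak-excluded-middle : (X : Set (c ⊔ ℓ)) → ¬ X ⊎ ¬ ¬ X
  weak-excluded-middle X with proj₂ chain _ _ (zeroOr-isIdeal X) (zeroOr-isIdeal (¬ X))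
  ... | inj₁ X⊆¬X = inj₁ λ x → refute (X⊆¬X (inj₂ x)) x
    where
    refute : zeroOr (¬ X) 1# → ¬ X
    refute (inj₁ (lift 1≈0)) = contradiction 1≈0 1≉0
    refute (inj₂ ¬x)         = ¬x
  ... | inj₂ ¬X⊆X = inj₂ λ ¬x → refute (¬X⊆X (inj₂ ¬x)) ¬x
    where
    refute : zeroOr X 1# → ¬ ¬ X
    refute (inj₁ (lift 1≈0)) = contradiction 1≈0 1≉0
    refute (inj₂ x)          = λ ¬x → ¬x x

  stable⇒dec : {X : Set (c ⊔ ℓ)} → Stable X → Dec X
  stable⇒dec {X} stable with weak-excluded-middle X
  ... | inj₁ ¬x  = no ¬x
  ... | inj₂ ¬¬x = yes (stable ¬¬x)

  multiples-isIdeal : ∀ d → IsIdeal R (d ∣_)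
  multiples-isIdeal d = record
    { resp = ∣ʳ-respʳ-≈
    ; has0 = d ∣0
    ; +-cl = λ { (q , qd≈x) (q′ , q′d≈y) → q + q′ , trans (distribʳ d q q′) (+-cong qd≈x q′d≈y) }
    ; *-cl = λ { r (q , qd≈x) → r * q , trans (*-assoc r q d) (*-congˡ qd≈x) }
    }

  ∣-total : ∀ a b → (a ∣ b) ⊎ (b ∣ a)
  ∣-total a b with proj₂ chain (a ∣_) (b ∣_) (multiples-isIdeal a) (multiples-isIdeal b)
  ... | inj₁ a∣⊆b∣ = inj₂ (a∣⊆b∣ ∣ʳ-refl)
  ... | inj₂ b∣⊆a∣ = inj₁ (b∣⊆a∣ ∣ʳ-refl)

  ∣-least : ∀ {n} (I : Subset n) → Nonempty I → (a : Fin n → Carrier) →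
            ∃[ t ] (t ∈ I × ∀ i → i ∈ I → a t ∣ a i)
  ∣-least (outside ∷ I) (suc i , there i∈I) a with ∣-least I (i , i∈I) (a ∘ suc)
  ... | t , t∈I , least = suc t , there t∈I , λ { (suc i) (there i∈I) → least i i∈I }
  ∣-least (inside ∷ I) _ a with nonempty? I
  ... | no I-empty =
    zero , here , λ { zero here → ∣ʳ-refl ; (suc i) (there i∈I) → contradiction (i , i∈I) I-empty }
  ... | yes I-nonempty with ∣-least I I-nonempty (a ∘ suc)
  ...   | t , t∈I , least with ∣-total (a zero) (a (suc t))
  ...     | inj₁ a₀∣aₜ =
    zero , here , λ { zero here → ∣ʳ-refl ; (suc i) (there i∈I) → ∣ʳ-trans a₀∣aₜ (least i i∈I) }
  ...     | inj₂ aₜ∣a₀ =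
    suc t , there t∈I , λ { zero here → aₜ∣a₀ ; (suc i) (there i∈I) → least i i∈I }

module RingSums {c ℓ} (R : CommutativeRing c ℓ) where
  open CommutativeRing R hiding (zero)
  open RingProperties ring using (-0#≈0#; -‿+-comm; x[y-z]≈xy-xz)
  open SubsetSum +-commutativeMonoid public
  open SubsetSumHomomorphism +-commutativeMonoid +-commutativeMonoid using (sumOver-hom)
  open import Relation.Binary.Reasoning.Setoid setoid

  sumOver-*ʳ : ∀ {n} (I : Subset n) (f : Fin n → Carrier) y → sumOver I f * y ≈ sumOver I (λ i → f i * y)
  sumOver-*ʳ I f y = sumOver-hom (_* y) (zeroˡ y) (distribʳ y) I f

  sumOver-neg : ∀ {n} (I : Subset n) (f : Fin n → Carrier) → - sumOver I f ≈ sumOver I (λ i → - f i)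
  sumOver-neg I f = sumOver-hom -_ -0#≈0# (λ x y → sym (-‿+-comm x y)) I f

  sumOver-eliminate : ∀ {n} (I : Subset n) (β x d : Fin n → Carrier) y →
                      sumOver I (λ i → β i * (x i - d i * y)) ≈
                      sumOver I (λ i → β i * x i) - sumOver I (λ i → β i * d i) * y
  sumOver-eliminate I β x d y = begin
    sumOver I (λ i → β i * (x i - d i * y))
      ≈⟨ sumOver-cong I (λ i → x[y-z]≈xy-xz (β i) (x i) _) ⟩
    sumOver I (λ i → β i * x i - β i * (d i * y))
      ≈⟨ sumOver-cong I (λ i → +-congˡ (-‿cong (sym (*-assoc (β i) (d i) y)))) ⟩
    sumOver I (λ i → β i * x i - β i * d i * y)
      ≈⟨ sumOver-distrib I _ _ ⟩
    sumOver I (λ i → β i * x i) + sumOver I (λ i → - (β i * d i * y))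
      ≈⟨ +-congˡ (sumOver-neg I _) ⟨
    sumOver I (λ i → β i * x i) - sumOver I (λ i → β i * d i * y)
      ≈⟨ +-congˡ (-‿cong (sumOver-*ʳ I _ y)) ⟨
    sumOver I (λ i → β i * x i) - sumOver I (λ i → β i * d i) * y
      ∎

  unitVector : ∀ {k} → Fin k → Fin k → Carrier
  unitVector j r = if does (r ≟ j) then 1# else 0#

  unitVector-diag : ∀ {k} (j : Fin k) → unitVector j j ≈ 1#
  unitVector-diag j rewrite dec-true (j ≟ j) ≡.refl = refl

  unitVector-off : ∀ {k} {j r : Fin k} → r ≢ j → unitVector j r ≈ 0#
  unitVector-off {j = j} {r} r≢j rewrite dec-false (r ≟ j) r≢j = refl

  free-sumOver-apply : ∀ {k n} (I : Subset n) (u : Fin n → Fin k → Carrier) r →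
                       subsetSum (λ _ → 0#) (λ x y r → x r + y r) I u r ≡ sumOver I (λ i → u i r)
  free-sumOver-apply []            u r = ≡.refl
  free-sumOver-apply (inside  ∷ I) u r = ≡.cong (u zero r +_) (free-sumOver-apply I (u ∘ suc) r)
  free-sumOver-apply (outside ∷ I) u r = free-sumOver-apply I (u ∘ suc) r

  FreeRelation : ∀ {k n} → (Fin n → Fin k → Carrier) → Subset n → (Fin n → Carrier) → Set ℓ
  FreeRelation u I α = ∀ r → sumOver I (λ i → α i * u i r) ≈ 0#

  modIndepFree-intro : ∀ {k n} {u : Fin n → Fin k → Carrier} {I} →
                       (∀ α → FreeRelation u I α → ∀ i → i ∈ I → 𝔪 R (α i)) → ModIndepFree R k u I
  modIndepFree-intro {u = u} {I} indep α relation =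
    indep α (λ r → ≡.subst (_≈ 0#) (free-sumOver-apply I (λ i r → α i * u i r) r) (relation r))

  modIndepFree-elim : ∀ {k n} {u : Fin n → Fin k → Carrier} {I} →
                      ModIndepFree R k u I → ∀ α → FreeRelation u I α → ∀ i → i ∈ I → 𝔪 R (α i)
  modIndepFree-elim {u = u} {I} indep α relation =
    indep α (λ r → ≡.subst (_≈ 0#) (≡.sym (free-sumOver-apply I (λ i r → α i * u i r) r)) (relation r))

  modIndepFree-cong : ∀ {k n} {u v : Fin n → Fin k → Carrier} {I} →
                      (∀ i r → u i r ≈ v i r) → ModIndepFree R k u I → ModIndepFree R k v I
  modIndepFree-cong {I = I} u≈v indep = modIndepFree-intro λ α relation →
    modIndepFree-elim indep α λ r → trans (sumOver-cong I (λ i → *-congˡ (u≈v i r))) (relation r)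

module FreeDependence {c ℓ} (R : CommutativeRing c ℓ) (chain : IsChainRing R) where
  open CommutativeRing R hiding (zero)
  open RingProperties ring using (-‿distribˡ-*; x≈y⇒x∙y⁻¹≈ε)
  open RingSums R
  open ChainRing R chain using (∣-least)
  open import Algebra.Properties.Semiring.Divisibility semiring using (_∣_; _∣ʳ_)
  open import Relation.Binary.Reasoning.Setoid setoid

  FreeUnitRelation : ∀ {k n} → (Fin n → Fin k → Carrier) → Subset n → Set (c ⊔ ℓ)
  FreeUnitRelation u I = ∃[ α ] (FreeRelation u I α × ∃[ i ] (i ∈ I × IsUnit R (α i)))

  quotients : ∀ {n} (I : Subset n) {x} {a : Fin n → Carrier} → (∀ i → i ∈ I → x ∣ a i) →
              ∃[ d ] (∀ i → i ∈ I → d i * x ≈ a i)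
  quotients I {x} {a} x∣a = d , d-spec
    where
    d : Fin _ → Carrier
    d i with i ∈? I
    ... | yes i∈I = _∣ʳ_.quotient (x∣a i i∈I)
    ... | no  _   = 0#
    d-spec : ∀ i → i ∈ I → d i * x ≈ a i
    d-spec i i∈I with i ∈? I
    ... | yes i∈I′ = _∣ʳ_.equality (x∣a i i∈I′)
    ... | no  i∉I  = contradiction i∈I i∉I

  -- A relation β among the reduced vectors lifts to u, with coefficient - ∑ β i * d i at the pivot t.
  eliminate : ∀ {k n} (I : Subset n) {t} → t ∈ I → (u : Fin n → Fin (suc k) → Carrier) (d : Fin n → Carrier) →
              (∀ i → i ∈ I → d i * u t zero ≈ u i zero) →
              FreeUnitRelation (λ i r → u i (suc r) - d i * u t (suc r)) (I ─ ⁅ t ⁆) → FreeUnitRelation u I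
  eliminate I {t} t∈I u d d-spec (β , relation , i₀ , i₀∈I─t , β-unit) =
    α , α-relation , i₀ , p─q⊆p I ⁅ t ⁆ i₀∈I─t , ≡.subst (IsUnit R) (≡.sym (α≡β i₀∈I─t)) β-unit
    where
    S = sumOver (I ─ ⁅ t ⁆) (λ i → β i * d i)
    α = updateAt β t (λ _ → - S)
    α≡β : ∀ {i} → i ∈ I ─ ⁅ t ⁆ → α i ≡ β i
    α≡β i∈I─t = updateAt-minimal _ t β (x∈p─⁅y⁆⇒x≢y I i∈I─t)
    reduce : ∀ r → sumOver I (λ i → α i * u i r) ≈ sumOver (I ─ ⁅ t ⁆) (λ i → β i * (u i r - d i * u t r))
    reduce r = begin
      sumOver I (λ i → α i * u i r)
        ≈⟨ sumOver-remove I _ t∈I ⟩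
      α t * u t r + sumOver (I ─ ⁅ t ⁆) (λ i → α i * u i r)
        ≈⟨ +-cong (*-congʳ (reflexive (updateAt-updates t β)))
                  (sumOver-cong-∈ (I ─ ⁅ t ⁆) (λ i i∈I─t → *-congʳ (reflexive (α≡β i∈I─t)))) ⟩
      - S * u t r + sumOver (I ─ ⁅ t ⁆) (λ i → β i * u i r)
        ≈⟨ +-congʳ (-‿distribˡ-* S (u t r)) ⟨
      - (S * u t r) + sumOver (I ─ ⁅ t ⁆) (λ i → β i * u i r)
        ≈⟨ +-comm _ _ ⟩
      sumOver (I ─ ⁅ t ⁆) (λ i → β i * u i r) - S * u t r
        ≈⟨ sumOver-eliminate (I ─ ⁅ t ⁆) β (λ i → u i r) d (u t r) ⟨
      sumOver (I ─ ⁅ t ⁆) (λ i → β i * (u i r - d i * u t r))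
        ∎
    α-relation : FreeRelation u I α
    α-relation zero    = trans (reduce zero) (sumOver-ε (I ─ ⁅ t ⁆) λ i i∈I─t → begin
      β i * (u i zero - d i * u t zero)  ≈⟨ *-congˡ (x≈y⇒x∙y⁻¹≈ε (sym (d-spec i (p─q⊆p I ⁅ t ⁆ i∈I─t)))) ⟩
      β i * 0#                           ≈⟨ zeroʳ (β i) ⟩
      0#                                 ∎)
    α-relation (suc r) = trans (reduce (suc r)) (relation r)

  ∣p∣>k⇒unitRelation : ∀ k {n} (I : Subset n) → k < ∣ I ∣ → (u : Fin n → Fin k → Carrier) → FreeUnitRelation u I
  ∣p∣>k⇒unitRelation zero I 0<∣I∣ u with t , t∈I ← 0<∣p∣⇒nonempty I 0<∣I∣ =
    (λ _ → 1#) , (λ ()) , t , t∈I , 1# , *-identityˡ 1#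
  ∣p∣>k⇒unitRelation (suc k) I 1+k<∣I∣ u
    with t , t∈I , pivot∣ ← ∣-least I (0<∣p∣⇒nonempty I (<-trans z<s 1+k<∣I∣)) (λ i → u i zero)
    with d , d-spec ← quotients I pivot∣ =
    eliminate I t∈I u d d-spec
      (∣p∣>k⇒unitRelation k (I ─ ⁅ t ⁆) k<∣I─t∣ (λ i r → u i (suc r) - d i * u t (suc r)))
    where
    k<∣I─t∣ : k < ∣ I ─ ⁅ t ⁆ ∣
    k<∣I─t∣ with s<s k<∣I─t∣ ← ≡.subst (suc k <_) (∣p∣≡1+∣p─⁅x⁆∣ I t∈I) 1+k<∣I∣ = k<∣I─t∣

  modIndepFree⇒∣p∣≤k : ∀ {k n} {u : Fin n → Fin k → Carrier} {I} → ModIndepFree R k u I → ∣ I ∣ ≤ k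
  modIndepFree⇒∣p∣≤k {k} {u = u} {I} indep with ∣ I ∣ ≤? k
  ... | yes ∣I∣≤k = ∣I∣≤k
  ... | no  ∣I∣≰k with α , relation , i , i∈I , α-unit ← ∣p∣>k⇒unitRelation k I (≰⇒> ∣I∣≰k) u =
    contradiction α-unit (modIndepFree-elim indep α relation i i∈I)

module Span {c ℓ m ℓm} (R : CommutativeRing c ℓ) (V : Module R m ℓm) where
  open CommutativeRing R hiding (zero)
  open Module V
  open RingSums R using (sumOver; unitVector; unitVector-diag; unitVector-off; modIndepFree-intro)
  module VSum = SubsetSum +ᴹ-commutativeMonoid
  open VSum using () renaming (sumOver to sumOverᴹ)
  open SubsetSumHomomorphism using (sumOver-hom)
  open import Relation.Binary.Reasoning.Setoid ≈ᴹ-setoid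

  linComb : ∀ {k} → (Fin k → Carrierᴹ) → (Fin k → Carrier) → Carrierᴹ
  linComb b x = sumOverᴹ ⊤ (λ r → x r *ₗ b r)

  infix 4 _∈Span_
  _∈Span_ : ∀ {k} → Carrierᴹ → (Fin k → Carrierᴹ) → Set (c ⊔ ℓm)
  v ∈Span b = ∃[ x ] (v ≈ᴹ linComb b x)

  *ₗ-sumOver : ∀ {n} a (I : Subset n) (f : Fin n → Carrierᴹ) → a *ₗ sumOverᴹ I f ≈ᴹ sumOverᴹ I (λ i → a *ₗ f i)
  *ₗ-sumOver a = sumOver-hom +ᴹ-commutativeMonoid +ᴹ-commutativeMonoid (a *ₗ_) (*ₗ-zeroʳ a) (*ₗ-distribˡ a)

  sumOver-*ₗ : ∀ {n} (I : Subset n) (g : Fin n → Carrier) v → sumOver I g *ₗ v ≈ᴹ sumOverᴹ I (λ i → g i *ₗ v)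
  sumOver-*ₗ I g v =
    sumOver-hom +-commutativeMonoid +ᴹ-commutativeMonoid (_*ₗ v) (*ₗ-zeroˡ v) (λ x y → *ₗ-distribʳ v x y) I g

  linComb-cong : ∀ {k} (b : Fin k → Carrierᴹ) {x y} → (∀ r → x r ≈ y r) → linComb b x ≈ᴹ linComb b y
  linComb-cong {k} b x≈y = VSum.sumOver-cong (⊤ {k}) (λ r → *ₗ-congʳ (x≈y r))

  linComb-unitVector : ∀ {k} (b : Fin k → Carrierᴹ) j → linComb b (unitVector j) ≈ᴹ b j
  linComb-unitVector {k} b j = begin
    linComb b (unitVector j)
      ≈⟨ VSum.sumOver-remove (⊤ {k}) _ ∈⊤ ⟩
    unitVector j j *ₗ b j +ᴹ sumOverᴹ (⊤ ─ ⁅ j ⁆) (λ r → unitVector j r *ₗ b r)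
      ≈⟨ +ᴹ-cong (*ₗ-congʳ (unitVector-diag j)) (VSum.sumOver-ε (⊤ ─ ⁅ j ⁆) λ r r∈⊤─j →
           ≈ᴹ-trans (*ₗ-congʳ (unitVector-off (x∈p─⁅y⁆⇒x≢y ⊤ r∈⊤─j))) (*ₗ-zeroˡ (b r))) ⟩
    1# *ₗ b j +ᴹ 0ᴹ
      ≈⟨ +ᴹ-identityʳ _ ⟩
    1# *ₗ b j
      ≈⟨ *ₗ-identityˡ (b j) ⟩
    b j
      ∎

  *ₗ-linComb : ∀ {k} a (b : Fin k → Carrierᴹ) x → a *ₗ linComb b x ≈ᴹ linComb b (λ r → a * x r)
  *ₗ-linComb {k} a b x =
    ≈ᴹ-trans (*ₗ-sumOver a (⊤ {k}) _) (VSum.sumOver-cong (⊤ {k}) (λ r → ≈ᴹ-sym (*ₗ-assoc a (x r) (b r))))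

  sumOver-linComb : ∀ {k n} (I : Subset n) (α : Fin n → Carrier) (b : Fin k → Carrierᴹ) (u : Fin n → Fin k → Carrier) →
                    sumOverᴹ I (λ i → α i *ₗ linComb b (u i)) ≈ᴹ linComb b (λ r → sumOver I (λ i → α i * u i r))
  sumOver-linComb {k} I α b u = begin
    sumOverᴹ I (λ i → α i *ₗ linComb b (u i))
      ≈⟨ VSum.sumOver-cong I (λ i → *ₗ-linComb (α i) b (u i)) ⟩
    sumOverᴹ I (λ i → sumOverᴹ ⊤ (λ r → (α i * u i r) *ₗ b r))
      ≈⟨ VSum.sumOver-comm I (⊤ {k}) _ ⟩
    sumOverᴹ ⊤ (λ r → sumOverᴹ I (λ i → (α i * u i r) *ₗ b r))
      ≈⟨ VSum.sumOver-cong (⊤ {k}) (λ r → sumOver-*ₗ I _ (b r)) ⟨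
    linComb b (λ r → sumOver I (λ i → α i * u i r))
      ∎

  basis∈Span : ∀ {k} (b : Fin k → Carrierᴹ) j → b j ∈Span b
  basis∈Span b j = unitVector j , ≈ᴹ-sym (linComb-unitVector b j)

  ∈Span-respˡ : ∀ {k} {b : Fin k → Carrierᴹ} {v v′} → v ≈ᴹ v′ → v′ ∈Span b → v ∈Span b
  ∈Span-respˡ v≈v′ (x , v′≈bx) = x , ≈ᴹ-trans v≈v′ v′≈bx

  ∈Span-trans : ∀ {k} {b b′ : Fin k → Carrierᴹ} →
                (∀ r → b r ∈Span b′) → ∀ {v} → v ∈Span b → v ∈Span b′
  ∈Span-trans {b = b} {b′} b⊆b′ {v} (x , v≈bx) = (λ s → sumOver ⊤ (λ r → x r * z r s)) , (begin
    v                                                 ≈⟨ v≈bx ⟩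
    sumOverᴹ ⊤ (λ r → x r *ₗ b r)                     ≈⟨ VSum.sumOver-cong ⊤ (λ r → *ₗ-congˡ (proj₂ (b⊆b′ r))) ⟩
    sumOverᴹ ⊤ (λ r → x r *ₗ linComb b′ (z r))        ≈⟨ sumOver-linComb ⊤ x b′ z ⟩
    linComb b′ (λ s → sumOver ⊤ (λ r → x r * z r s))  ∎)
    where
    z : _ → _ → Carrier
    z r = proj₁ (b⊆b′ r)

  ∈Span-of-relation : ∀ {k} (b : Fin k → Carrierᴹ) β {v γ} →
                      linComb b β +ᴹ γ *ₗ v ≈ᴹ 0ᴹ → IsUnit R γ → v ∈Span b
  ∈Span-of-relation b β {v} {γ} relation (u , γu≈1) = (λ r → - u * β r) , ≈ᴹ-sym (begin
    linComb b (λ r → - u * β r)                 ≈⟨ *ₗ-linComb (- u) b β ⟨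
    (- u) *ₗ w                                  ≈⟨ +ᴹ-identityʳ _ ⟨
    (- u) *ₗ w +ᴹ 0ᴹ                            ≈⟨ +ᴹ-congˡ (≈ᴹ-trans (*ₗ-congˡ relation) (*ₗ-zeroʳ u)) ⟨
    (- u) *ₗ w +ᴹ u *ₗ (w +ᴹ γ *ₗ v)            ≈⟨ +ᴹ-congˡ (*ₗ-distribˡ u w _) ⟩
    (- u) *ₗ w +ᴹ (u *ₗ w +ᴹ u *ₗ (γ *ₗ v))     ≈⟨ +ᴹ-assoc _ _ _ ⟨
    ((- u) *ₗ w +ᴹ u *ₗ w) +ᴹ u *ₗ (γ *ₗ v)     ≈⟨ +ᴹ-cong (*ₗ-distribʳ w (- u) u) (*ₗ-assoc u γ v) ⟨
    (- u + u) *ₗ w +ᴹ (u * γ) *ₗ v              ≈⟨ +ᴹ-cong (*ₗ-congʳ (-‿inverseˡ u)) (*ₗ-congʳ (trans (*-comm u γ) γu≈1)) ⟩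
    0# *ₗ w +ᴹ 1# *ₗ v                          ≈⟨ +ᴹ-cong (*ₗ-zeroˡ w) (*ₗ-identityˡ v) ⟩
    0ᴹ +ᴹ v                                     ≈⟨ +ᴹ-identityˡ v ⟩
    v                                           ∎)
    where
    w = linComb b β

  modIndep-linComb⇒modIndepFree : ∀ {k n} (b : Fin k → Carrierᴹ) (u : Fin n → Fin k → Carrier) I →
                                  ModIndep R V (linComb b ∘ u) I → ModIndepFree R k u I
  modIndep-linComb⇒modIndepFree {k} b u I indep = modIndepFree-intro λ α relation → indep α (begin
    sumOverᴹ I (λ i → α i *ₗ linComb b (u i))        ≈⟨ sumOver-linComb I α b u ⟩
    linComb b (λ r → sumOver I (λ i → α i * u i r))  ≈⟨ linComb-cong b relation ⟩
    linComb b (λ _ → 0#)                             ≈⟨ VSum.sumOver-ε (⊤ {k}) (λ r _ → *ₗ-zeroˡ (b r)) ⟩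
    0ᴹ                                               ∎)

module UniformRepresentation {c ℓ m ℓm} (R : CommutativeRing c ℓ) (V : Module R m ℓm) where
  open Module V
  open Span R V using (module VSum)
  open VSum using () renaming (sumOver to sumOverᴹ)
  open import Relation.Binary.Reasoning.Setoid ≈ᴹ-setoid

  IsUniformRep : ∀ k {n} → (Fin n → Carrierᴹ) → Set (c ⊔ ℓ ⊔ ℓm)
  IsUniformRep k {n} w = ∀ I → UniformIndep k n I ⇔ ModIndep R V w I

  UnitRelation : ∀ {n} → (Fin n → Carrierᴹ) → Subset n → Set (c ⊔ ℓ ⊔ ℓm)
  UnitRelation {n} w I =
    Σ[ α ∈ (Fin n → CommutativeRing.Carrier R) ]
      (sumOverᴹ I (λ i → α i *ₗ w i) ≈ᴹ 0ᴹ × ∃[ i ] (i ∈ I × IsUnit R (α i)))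

  ¬modIndep⇒¬¬unitRelation : ∀ {n} {w : Fin n → Carrierᴹ} {I} → ¬ ModIndep R V w I → ¬ ¬ UnitRelation w I
  ¬modIndep⇒¬¬unitRelation ¬indep ¬relation =
    ¬indep λ α relation i i∈I α-unit → ¬relation (α , relation , i , i∈I , α-unit)

  modIndep-cong : ∀ {n} {w w′ : Fin n → Carrierᴹ} {I} →
                  (∀ i → w i ≈ᴹ w′ i) → ModIndep R V w I → ModIndep R V w′ I
  modIndep-cong {I = I} w≈w′ indep α relation =
    indep α (≈ᴹ-trans (VSum.sumOver-cong I (λ i → *ₗ-congˡ (w≈w′ i))) relation)

  modIndep-image : ∀ {n} (w : Fin n → Carrierᴹ) (ρ : Permutation n n) I →
                   ModIndep R V w (image ρ I) → ModIndep R V (w ∘ (ρ ⟨$⟩ʳ_)) I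
  modIndep-image w ρ I indep α relation i i∈I =
    ≡.subst (𝔪 R ∘ α) (inverseˡ ρ) (indep (α ∘ (ρ ⟨$⟩ˡ_)) relation′ (ρ ⟨$⟩ʳ i) (∈-image ρ i∈I))
    where
    relation′ : sumOverᴹ (image ρ I) (λ x → α (ρ ⟨$⟩ˡ x) *ₗ w x) ≈ᴹ 0ᴹ
    relation′ = begin
      sumOverᴹ (image ρ I) (λ x → α (ρ ⟨$⟩ˡ x) *ₗ w x)
        ≈⟨ VSum.sumOver-permute ρ I _ ⟩
      sumOverᴹ I (λ i → α (ρ ⟨$⟩ˡ (ρ ⟨$⟩ʳ i)) *ₗ w (ρ ⟨$⟩ʳ i))
        ≈⟨ VSum.sumOver-cong I (λ i → ≈ᴹ-reflexive (≡.cong (λ j → α j *ₗ w (ρ ⟨$⟩ʳ i)) (inverseˡ ρ))) ⟩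
      sumOverᴹ I (λ i → α i *ₗ w (ρ ⟨$⟩ʳ i))
        ≈⟨ relation ⟩
      0ᴹ
        ∎

  modIndep-preimage : ∀ {n} (w : Fin n → Carrierᴹ) (ρ : Permutation n n) I →
                      ModIndep R V (w ∘ (ρ ⟨$⟩ʳ_)) I → ModIndep R V w (image ρ I)
  modIndep-preimage w ρ I indep α relation x x∈ρI =
    ≡.subst (𝔪 R ∘ α) (inverseʳ ρ) (indep (α ∘ (ρ ⟨$⟩ʳ_)) relation′ (ρ ⟨$⟩ˡ x) (image-∈ ρ x∈ρI))
    where
    relation′ : sumOverᴹ I (λ i → α (ρ ⟨$⟩ʳ i) *ₗ w (ρ ⟨$⟩ʳ i)) ≈ᴹ 0ᴹ
    relation′ = ≈ᴹ-trans (≈ᴹ-sym (VSum.sumOver-permute ρ I _)) relation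

  isUniformRep-permute : ∀ {k n} {w : Fin n → Carrierᴹ} → IsUniformRep k w →
                         (ρ : Permutation n n) → IsUniformRep k (w ∘ (ρ ⟨$⟩ʳ_))
  isUniformRep-permute {k} {w = w} uniform ρ I = mk⇔
    (λ ∣I∣≤k → modIndep-image w ρ I (Equivalence.to (uniform (image ρ I)) (≡.subst (_≤ k) (≡.sym ∣ρI∣≡∣I∣) ∣I∣≤k)))
    (λ indep → ≡.subst (_≤ k) ∣ρI∣≡∣I∣ (Equivalence.from (uniform (image ρ I)) (modIndep-preimage w ρ I indep)))
    where
    ∣ρI∣≡∣I∣ = ∣image∣≡∣p∣ ρ I

module StandardForm {c ℓ} (R : CommutativeRing c ℓ) (k p : ℕ) where
  open CommutativeRing R hiding (zero)
  open RingSums R using (unitVector)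

  column : (Fin p → Fin k → Carrier) → Fin (k +ℕ p) → Fin k → Carrier
  column P y = [ unitVector , P ]′ (splitAt k y)

  column-cong : ∀ {P Q} → (∀ t r → P t r ≈ Q t r) → ∀ y r → column P y r ≈ column Q y r
  column-cong P≈Q y r with splitAt k y
  ... | inj₁ _ = refl
  ... | inj₂ t = P≈Q t r

  column-↑ˡ : ∀ P j → column P (j ↑ˡ p) ≡ unitVector j
  column-↑ˡ P j rewrite splitAt-↑ˡ k j p = ≡.refl

module Exchange {c ℓ m ℓm} (R : CommutativeRing c ℓ) (V : Module R m ℓm) (k p : ℕ) where
  open Module V
  open Span R V
  open VSum using () renaming (sumOver to sumOverᴹ)
  open UniformRepresentation R V
  open StandardForm R k p
  open import Relation.Binary.Reasoning.Setoid ≈ᴹ-setoid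

  B : Fin k → Fin (k +ℕ p)
  B r = r ↑ˡ p

  Y : Fin p → Fin (k +ℕ p)
  Y t = k ↑ʳ t

  basis : (Fin (k +ℕ p) → Carrierᴹ) → Fin k → Carrierᴹ
  basis w = w ∘ B

  basisWith : Fin p → Subset (k +ℕ p)
  basisWith t = ⊤ ++ ⁅ t ⁆

  basisWith-dependent : ∀ {w} → IsUniformRep k w → ∀ t → ¬ ModIndep R V w (basisWith t)
  basisWith-dependent uniform t indep =
    n≮n k (≡.subst (_≤ k) ∣basisWith∣≡1+k (Equivalence.from (uniform (basisWith t)) indep))
    where
    ∣basisWith∣≡1+k : ∣ basisWith t ∣ ≡ suc k
    ∣basisWith∣≡1+k =
      ≡.trans (∣p++q∣≡∣p∣+∣q∣ (⊤ {k}) ⁅ t ⁆) (≡.trans (≡.cong₂ _+ℕ_ (∣⊤∣≡n k) (∣⁅x⁆∣≡1 t)) (ℕ.+-comm k 1))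

  sumOver-basisWith : ∀ t (f : Fin (k +ℕ p) → Carrierᴹ) →
                      sumOverᴹ (basisWith t) f ≈ᴹ sumOverᴹ ⊤ (f ∘ B) +ᴹ f (Y t)
  sumOver-basisWith t f = ≈ᴹ-trans (VSum.sumOver-++ (⊤ {k}) ⁅ t ⁆ f) (+ᴹ-congˡ (VSum.sumOver-⁅⁆ t _))

  record Exchanged (w : Fin (k +ℕ p) → Carrierᴹ) (t : Fin p) : Set (c ⊔ ℓ ⊔ m ⊔ ℓm) where
    field
      exchanged  : Fin (k +ℕ p) → Carrierᴹ
      uniform    : IsUniformRep k exchanged
      span-⊆     : ∀ {v} → v ∈Span basis w → v ∈Span basis exchanged
      pivot∈Span : exchanged (Y t) ∈Span basis exchanged
      others     : ∀ {t′} → t′ ≢ t → exchanged (Y t′) ≡ w (Y t′)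

  swap-into-basis : ∀ {w} → IsUniformRep k w → ∀ t r₀ α →
                    linComb (basis w) (α ∘ B) +ᴹ α (Y t) *ₗ w (Y t) ≈ᴹ 0ᴹ → IsUnit R (α (B r₀)) → Exchanged w t
  swap-into-basis {w} uniform t r₀ α relation α₀-unit = record
    { exchanged  = w′
    ; uniform    = isUniformRep-permute uniform τ
    ; span-⊆     = ∈Span-trans basis⊆
    ; pivot∈Span = ∈Span-respˡ (≈ᴹ-reflexive (≡.cong w (transpose-matchʳ (B r₀) (Y t)))) B₀∈Span
    ; others     = λ t′≢t → ≡.cong w (transpose-other (↑ˡ≢↑ʳ r₀ _ ∘ ≡.sym) (t′≢t ∘ ↑ʳ-injective k _ t))
    }
    where
    τ = transpose (B r₀) (Y t)
    w′ = w ∘ (τ ⟨$⟩ʳ_)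
    w′-B : ∀ {r} → r ≢ r₀ → w′ (B r) ≡ w (B r)
    w′-B r≢r₀ = ≡.cong w (transpose-other (r≢r₀ ∘ ↑ˡ-injective p _ r₀) (↑ˡ≢↑ʳ _ t))
    β = updateAt (α ∘ B) r₀ (λ _ → α (Y t))
    β-w′-B : ∀ r → r ∈ ⊤ ─ ⁅ r₀ ⁆ → α (B r) *ₗ w (B r) ≈ᴹ β r *ₗ w′ (B r)
    β-w′-B r r∈⊤─r₀ = ≈ᴹ-reflexive (≡.sym (≡.cong₂ _*ₗ_ (updateAt-minimal r r₀ (α ∘ B) r≢r₀) (w′-B r≢r₀)))
      where r≢r₀ = x∈p─⁅y⁆⇒x≢y ⊤ r∈⊤─r₀
    relation′ : linComb (basis w′) β +ᴹ α (B r₀) *ₗ w (B r₀) ≈ᴹ 0ᴹ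
    relation′ = begin
      linComb (basis w′) β +ᴹ α (B r₀) *ₗ w (B r₀)
        ≈⟨ VSum.sumOver-exchange ⊤ (λ r → α (B r) *ₗ w (B r)) (λ r → β r *ₗ w′ (B r)) ∈⊤ β-w′-B ⟩
      linComb (basis w) (α ∘ B) +ᴹ β r₀ *ₗ w′ (B r₀)
        ≈⟨ +ᴹ-congˡ (≈ᴹ-reflexive (≡.cong₂ _*ₗ_ (updateAt-updates r₀ (α ∘ B))
                                                (≡.cong w (transpose-matchˡ (B r₀) (Y t))))) ⟩
      linComb (basis w) (α ∘ B) +ᴹ α (Y t) *ₗ w (Y t)
        ≈⟨ relation ⟩
      0ᴹ
        ∎
    B₀∈Span : w (B r₀) ∈Span basis w′
    B₀∈Span = ∈Span-of-relation (basis w′) β relation′ α₀-unit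
    basis⊆ : ∀ r → w (B r) ∈Span basis w′
    basis⊆ r with r ≟ r₀
    ... | yes ≡.refl = B₀∈Span
    ... | no  r≢r₀   = ∈Span-respˡ (≈ᴹ-reflexive (≡.sym (w′-B r≢r₀))) (basis∈Span (basis w′) r)

  exchange-along : ∀ {w} → IsUniformRep k w → ∀ t → UnitRelation w (basisWith t) → Exchanged w t
  exchange-along {w} uniform t (α , relation , x , x∈basisWith , α-unit)
    with splitAt k x | join-splitAt k p x
  ... | inj₁ r₀ | ≡.refl = swap-into-basis uniform t r₀ α relation′ α-unit
    where relation′ = ≈ᴹ-trans (≈ᴹ-sym (sumOver-basisWith t _)) relation
  ... | inj₂ t′ | ≡.refl with ≡.refl ← x∈⁅y⁆⇒x≡y t (↑ʳ-∈-++ ⊤ ⁅ t ⁆ x∈basisWith) = record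
    { exchanged  = w
    ; uniform    = uniform
    ; span-⊆     = id
    ; pivot∈Span = ∈Span-of-relation (basis w) (α ∘ B) relation′ α-unit
    ; others     = λ _ → ≡.refl
    }
    where relation′ = ≈ᴹ-trans (≈ᴹ-sym (sumOver-basisWith t _)) relation

  exchange : ∀ {w} → IsUniformRep k w → ∀ t → ¬ ¬ Exchanged w t
  exchange uniform t =
    ¬¬-map (exchange-along uniform t) (¬modIndep⇒¬¬unitRelation (basisWith-dependent uniform t))

  Processed : ℕ → (Fin (k +ℕ p) → Carrierᴹ) → Set (c ⊔ ℓ ⊔ ℓm)
  Processed j w = IsUniformRep k w × (∀ t → toℕ t < j → w (Y t) ∈Span basis w)

  process : ∀ {w₀} → IsUniformRep k w₀ → ∀ j → j ≤ p → ¬ ¬ ∃ (Processed j)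
  process {w₀} uniform zero    _   ¬processed = ¬processed (w₀ , uniform , λ _ ())
  process      uniform (suc j) j<p = negated-stable (¬¬-map extend (process uniform j (<⇒≤ j<p)))
    where
    t = fromℕ< j<p
    extend : ∃ (Processed j) → ¬ ¬ ∃ (Processed (suc j))
    extend (w , uniform′ , done) = ¬¬-map (λ e → exchanged e , Exchanged.uniform e , done′ e) (exchange uniform′ t)
      where
      open Exchanged using (exchanged; span-⊆; pivot∈Span; others)
      done′ : (e : Exchanged w t) → ∀ t′ → toℕ t′ < suc j → exchanged e (Y t′) ∈Span basis (exchanged e)
      done′ e t′ t′<1+j with m<1+n⇒m<n∨m≡n t′<1+j
      ... | inj₁ t′<j = ∈Span-respˡ (≈ᴹ-reflexive (others e t′≢t)) (span-⊆ e (done t′ t′<j))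
        where
        t′≢t : t′ ≢ t
        t′≢t t′≡t = <⇒≢ t′<j (≡.trans (≡.cong toℕ t′≡t) (toℕ-fromℕ< j<p))
      ... | inj₂ t′≡j with ≡.refl ← toℕ-injective {i = t′} {j = t} (≡.trans t′≡j (≡.sym (toℕ-fromℕ< j<p))) =
        pivot∈Span e

  coordinates : ∀ {w} → (∀ t → w (Y t) ∈Span basis w) → ∃[ P ] ∀ y → w y ≈ᴹ linComb (basis w) (column P y)
  coordinates {w} spanned = P , coordinate
    where
    P = λ t → proj₁ (spanned t)
    coordinate : ∀ y → w y ≈ᴹ linComb (basis w) (column P y)
    coordinate y with splitAt k y | join-splitAt k p y
    ... | inj₁ r | ≡.refl = ≈ᴹ-sym (linComb-unitVector (basis w) r)
    ... | inj₂ t | ≡.refl = proj₂ (spanned t)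

Searchable : ∀ {a ℓ₁} (A : Set a) → Rel A ℓ₁ → (ℓ₂ : Level) → Set (lsuc a ⊔ ℓ₁ ⊔ lsuc ℓ₂)
Searchable {a} A _~_ ℓ₂ = ∀ {P : Pred A (a ⊔ ℓ₂)} → P Respects _~_ → Decidable P → Dec (∃ P)

covered⇒searchable : ∀ {a ℓ₁ ℓ₂} {A : Set a} {_~_ : Rel A ℓ₁} → Symmetric _~_ →
                     ∀ {q} (f : Fin q → A) → (∀ x → ∃ λ i → f i ~ x) → Searchable A _~_ ℓ₂
covered⇒searchable sym f covers resp P? with any? (P? ∘ f)
... | yes (i , Pfi) = yes (f i , Pfi)
... | no  ¬∃        = no λ (x , Px) → let i , fi~x = covers x in ¬∃ (i , resp (sym fi~x) Px)

searchable-Π : ∀ {a ℓ₁ ℓ₂} {A : Set a} {_~_ : Rel A ℓ₁} → Reflexive _~_ → Searchable A _~_ ℓ₂ →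
               ∀ n → Searchable (Fin n → A) (Pointwise _~_) ℓ₂
searchable-Π refl search zero resp P? =
  Dec.map′ (Vector.[] ,_) (λ (f , Pf) → resp (λ ()) Pf) (P? Vector.[])
searchable-Π {ℓ₂ = ℓ₂} {_~_ = _~_} refl search (suc n) {P} resp P? =
  Dec.map′ (λ (x , xs , P[x∷xs]) → x Vector.∷ xs , P[x∷xs])
           (λ (f , Pf) → head f , tail f , resp (λ { zero → refl ; (suc i) → refl }) Pf)
           (search resp-head (λ x → searchable-Π {ℓ₂ = ℓ₂} refl search n (resp-tail x) (P? ∘ (x Vector.∷_))))
  where
  resp-head : (λ x → ∃ λ xs → P (x Vector.∷ xs)) Respects _~_
  resp-head x~y (xs , P[x∷xs]) = xs , resp (λ { zero → x~y ; (suc i) → refl }) P[x∷xs]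
  resp-tail : ∀ x → (P ∘ (x Vector.∷_)) Respects Pointwise _~_
  resp-tail x xs~ys = resp (λ { zero → refl ; (suc i) → xs~ys i })

module Main {c ℓ m ℓm} (R : CommutativeRing c ℓ) (finite : IsFinite R) (chain : IsChainRing R)
            (V : Module R m ℓm) (k p : ℕ) where
  open CommutativeRing R hiding (zero)
  open RingSums R using (unitVector-diag; unitVector-off; modIndepFree-cong)
  open ChainRing R chain using (stable⇒dec)
  open FreeDependence R chain using (modIndepFree⇒∣p∣≤k)
  open Span R V using (modIndep-linComb⇒modIndepFree)
  open UniformRepresentation R V using (IsUniformRep; modIndep-cong)
  open StandardForm R k p
  open Exchange R V k p using (Processed; process; coordinates; basis)

  RepresentsIndependents : (Fin p → Fin k → Carrier) → Set (c ⊔ ℓ)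
  RepresentsIndependents P = ∀ I → ∣ I ∣ ≤ k → ModIndepFree R k (column P) I

  ¬¬representsIndependents : ∀ {w} → IsUniformRep k w → ¬ ¬ ∃ RepresentsIndependents
  ¬¬representsIndependents uniform = ¬¬-map represent (process uniform p ≤-refl)
    where
    represent : ∃ (Processed p) → ∃ RepresentsIndependents
    represent (w , uniform′ , done) with P , w≈ ← coordinates (λ t → done t (toℕ<n t)) =
      P , λ I ∣I∣≤k → modIndep-linComb⇒modIndepFree (basis w) (column P) I
                        (modIndep-cong w≈ (Equivalence.to (uniform′ I) ∣I∣≤k))

  representsIndependents : ∀ {w} → IsUniformRep k w → ∃ RepresentsIndependents
  representsIndependents uniform =
    decidable-stable (search respects (stable⇒dec ∘ stable)) (¬¬representsIndependents uniform)
    where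
    search : Searchable (Fin p → Fin k → Carrier) (Pointwise (Pointwise _≈_)) ℓ
    search = searchable-Π {ℓ₂ = ℓ} (λ _ → refl)
               (searchable-Π {ℓ₂ = ℓ} refl (covered⇒searchable {ℓ₂ = ℓ} sym enumerate covers) k) p
      where
      enumerate = proj₁ (proj₂ finite)
      covers    = proj₂ (proj₂ finite)
    respects : RepresentsIndependents Respects Pointwise (Pointwise _≈_)
    respects P≈Q represents I ∣I∣≤k = modIndepFree-cong (column-cong P≈Q) (represents I ∣I∣≤k)
    stable : ∀ P → Stable (RepresentsIndependents P)
    stable P ¬¬represents I ∣I∣≤k α relation i i∈I α-unit =
      ¬¬represents λ represents → represents I ∣I∣≤k α relation i i∈I α-unit

  freelyRepresentable : ∃ RepresentsIndependents → FreelyRepresentable R (UniformIndep k (k +ℕ p))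
  freelyRepresentable (P , represents) =
    k , p , (λ r y → column P y r) , ↔-id _ , identity , ↔-id _ , λ I → mk⇔ (represents I) modIndepFree⇒∣p∣≤k
    where
    identity : ∀ (r j : Fin k) → (r ≡ j → column P (j ↑ˡ p) r ≈ 1#) × (¬ r ≡ j → column P (j ↑ˡ p) r ≈ 0#)
    identity r j rewrite column-↑ˡ P j = (λ { ≡.refl → unitVector-diag r }) , unitVector-off

freelyRepresentable-resp : ∀ {c ℓ} (R : CommutativeRing c ℓ) {n} {P Q : Subset n → Set} →
                           (∀ I → P I → Q I) → (∀ I → Q I → P I) →
                           FreelyRepresentable R P → FreelyRepresentable R Q
freelyRepresentable-resp R P⇒Q Q⇒P (k , p , A , π , identity , σ , represents) =
  k , p , A , π , identity , σ ,
  λ I → mk⇔ (Equivalence.to (represents I) ∘ Q⇒P I) (P⇒Q I ∘ Equivalence.from (represents I))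

uniformRep⇒freelyRepresentable : ∀ {c ℓ m ℓm} (R : CommutativeRing c ℓ) → IsFinite R → IsChainRing R →
                                 (V : Module R m ℓm) → ∀ {k n} {w : Fin n → Module.Carrierᴹ V} →
                                 UniformRepresentation.IsUniformRep R V k w → k ≤ n →
                                 FreelyRepresentable R (UniformIndep k n)
uniformRep⇒freelyRepresentable R finite chain V {k} uniform k≤n with m≤n⇒∃[o]m+o≡n k≤n
... | p , ≡.refl = freelyRepresentable (representsIndependents uniform)
  where open Main R finite chain V k p

proposition5p3 : ∀ {c ℓ} (R : CommutativeRing c ℓ) → IsFiniteChainRing R →
    ∀ (m ℓm : Level) (k n : ℕ) →
    Representable R m ℓm (UniformIndep k n) →
    FreelyRepresentable R (UniformIndep k n)
proposition5p3 R (finite , chain) m ℓm k n (e , V , A , σ , uniform) with k ≤? n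
... | yes k≤n = uniformRep⇒freelyRepresentable R finite chain V uniform k≤n
... | no  k≰n = freelyRepresentable-resp R (λ I _ → ≤-trans (∣p∣≤n I) n≤k) (λ I _ → ∣p∣≤n I)
                  (uniformRep⇒freelyRepresentable R finite chain V saturated ≤-refl)
  where
  n≤k = ≰⇒≥ k≰n
  saturated : ∀ I → UniformIndep n n I ⇔ ModIndep R V (A ∘ Inverse.to σ) I
  saturated I = mk⇔ (λ _ → Equivalence.to (uniform I) (≤-trans (∣p∣≤n I) n≤k)) (λ _ → ∣p∣≤n I)
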